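{- Let $E/\mathbb{Q}$ be an elliptic curve given by a Weierstrass equation with integer coefficients, and assume that for all $\epsilon>0$ there is a constant $c_\epsilon$ with $\max\{\frac12\log|a_Q|,\log|d_Q|\}\le(1+\epsilon)\log\operatorname{rad}(d_Q)+c_\epsilon$ for all $Q\in E(\mathbb{Q})\setminus\{O\}$. Then for all $\epsilon>0$ there exists a constant $c'_\epsilon$ such that \[ \log v_Q\le \epsilon\log\operatorname{rad}(d_Q)+c'_\epsilon \] for all $Q\in E(\mathbb{Q})\setminus\{O\}$.
   Context: $O$ is the point at infinity. Every $Q\in E(\mathbb{Q})\setminus\{O\}$ is written $Q=(a_Q/d_Q^2,\,b_Q/d_Q^3)$ with $a_Q,b_Q,d_Q\in\mathbb{Z}$, $d_Q\ge1$, $\gcd(d_Q,a_Qb_Q)=1$; $\operatorname{rad}(n)$ is the product of distinct primes dividing $n$. Write $d_Q=d'_Q\cdot v_Q$, where $d'_Q$ is the product of the primes dividing $d_Q$ exactly once and $v_Q=d_Q/d'_Q$ (so every prime dividing $v_Q$ divides it at least twice).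
   Formalization: Both in the assumed bound and in the conclusion, the parameter ε ranges over the positive rationals. -}

module Defs where

open import Data.Nat as N using (ℕ; _≤_; _^_; NonZero)
open import Data.Nat.DivMod using (_/_)
open import Data.Nat.Divisibility using (_∣_; _∣?_)
open import Data.Nat.Primality using (Prime; prime?; productOfPrimes≢0)
open import Data.Nat.GCD using (gcd)
open import Data.Integer as Z using (ℤ; ∣_∣)
open import Data.Rational as Q using (ℚ)
open import Data.List using (List; filter; upTo)
open import Data.Nat.ListAction using (product)
open import Relation.Unary using (Decidable)
open import Data.List.Relation.Unary.All as All using (All)
open import Data.List.Relation.Unary.All.Properties using (all-filter)
open import Data.Product using (_×_; proj₁; ∃)
open import Relation.Nullary using (¬_)
open import Relation.Nullary.Decidable using (_×-dec_; ¬?)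
open import Relation.Binary.PropositionalEquality using (_≡_; _≢_)

-- Elliptic curves over ℚ given by an integral Weierstrass equation
--   y² + a₁xy + a₃y = x³ + a₂x² + a₄x + a₆ ,  aᵢ ∈ ℤ,  Δ ≠ 0.

record Weierstrass : Set where
  field
    a₁ a₂ a₃ a₄ a₆ : ℤ

module _ (E : Weierstrass) where
  open Weierstrass E
  open Z using (_+_; _-_; _*_; -_)

  b₂ b₄ b₆ b₈ : ℤ
  b₂ = a₁ * a₁ + Z.+ 4 * a₂
  b₄ = Z.+ 2 * a₄ + a₁ * a₃
  b₆ = a₃ * a₃ + Z.+ 4 * a₆
  b₈ = a₁ * a₁ * a₆ + Z.+ 4 * a₂ * a₆ - a₁ * a₃ * a₄ + a₂ * a₃ * a₃ - a₄ * a₄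

  discriminant : ℤ
  discriminant = - (b₂ * b₂ * b₈) - Z.+ 8 * (b₄ * b₄ * b₄)
                 - Z.+ 27 * (b₆ * b₆) + Z.+ 9 * (b₂ * b₄ * b₆)

IsElliptic : Weierstrass → Set
IsElliptic E = discriminant E ≢ Z.0ℤ

ι : ℤ → ℚ
ι z = z Q./ 1

-- (x , y) is an affine rational point of E, i.e. a point of E(ℚ) ∖ {O}
OnCurve : Weierstrass → ℚ → ℚ → Set
OnCurve E x y =
  y * y + ι a₁ * x * y + ι a₃ * y ≡ x * x * x + ι a₂ * x * x + ι a₄ * x + ι a₆
  where open Weierstrass E
        open Q using (_+_; _*_)

Rep : ℚ → ℚ → ℤ → ℤ → ℕ → Set
Rep x y a b d =
  1 ≤ d × gcd d ∣ a Z.* b ∣ ≡ 1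
  × x Q.* ι (Z.+ (d ^ 2)) ≡ ι a
  × y Q.* ι (Z.+ (d ^ 3)) ≡ ι b

rad : ℕ → ℕ
rad n = product (filter (λ p → prime? p ×-dec (p ∣? n)) (upTo (N.suc n)))

OnceDivides : ℕ → ℕ → Set
OnceDivides n p = Prime p × (p ∣ n × ¬ ((p N.* p) ∣ n))

onceDivides? : (n : ℕ) → Decidable (OnceDivides n)
onceDivides? n p = prime? p ×-dec ((p ∣? n) ×-dec ¬? ((p N.* p) ∣? n))

primesOnce : ℕ → List ℕ
primesOnce n = filter (onceDivides? n) (upTo (N.suc n))

sqfreePart : ℕ → ℕ
sqfreePart n = product (primesOnce n)

sqfreePart≢0 : ∀ n → NonZero (sqfreePart n)
sqfreePart≢0 n = productOfPrimes≢0 (All.map proj₁ (all-filter (onceDivides? n) (upTo (N.suc n))))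

vPart : ℕ → ℕ
vPart n = _/_ n (sqfreePart n) {{sqfreePart≢0 n}}

-- The log-inequalities, with ε = p / q (p , q ≥ 1) and a constant c,
-- exponentiated:  log X ≤ (p/q) log R + c  ⟺  X^q ≤ e^{qc} R^p.

Hypothesis : Weierstrass → Set
Hypothesis E =
  ∀ (p q : ℕ) → 1 ≤ p → 1 ≤ q → ∃ λ (K : ℕ) →
    ∀ (x y : ℚ) (a b : ℤ) (d : ℕ) → OnCurve E x y → Rep x y a b d →
      ∣ a ∣ ^ q ≤ K N.* rad d ^ (2 N.* (q N.+ p))
      × d ^ q ≤ K N.* rad d ^ (q N.+ p)

Conclusion : Weierstrass → Set
Conclusion E =
  ∀ (p q : ℕ) → 1 ≤ p → 1 ≤ q → ∃ λ (K : ℕ) →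
    ∀ (x y : ℚ) (a b : ℤ) (d : ℕ) → OnCurve E x y → Rep x y a b d →
      vPart d ^ q ≤ K N.* rad d ^ p

{-# OPTIONS --safe #-}
-- Write d = d′ v and let T be the product of the primes whose square divides d,
-- i.e. T = rad v. Every prime of d divides it exactly once or at least twice, so
-- rad d = d′ T, and d′ T² divides d, whence T² ≤ v. The hypothesis with ε = p/(2q)
-- reads (d′ v)^{2q} ≤ K (d′ T)^{2q+p}.
module Submission where

open import Defs
open import Algebra.Properties.CommutativeSemigroup as CommSemigroup using ()
open import Data.Bool using (true; false; if_then_else_)
open import Data.List using (List; []; _∷_; filter; map; upTo)
open import Data.List.Properties using (map-cong)
open import Data.List.Relation.Unary.All using (All; []; _∷_)
open import Data.List.Relation.Unary.AllPairs using (AllPairs; []; _∷_)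
open import Data.List.Relation.Unary.AllPairs.Properties using (applyUpTo⁺₁)
open import Data.Nat
open import Data.Nat.Divisibility
open import Data.Nat.DivMod using (m*[n/m]≡n)
open import Data.Nat.ListAction using (product)
open import Data.Nat.Primality
open import Data.Nat.Properties
open import Data.Nat.Tactic.RingSolver using (solve-∀)
open import Data.Product using (_×_; _,_; proj₁; proj₂)
open import Data.Sum using (inj₁; inj₂; [_,_]′)
open import Function using (id; it)
open import Relation.Binary.PropositionalEquality
open import Relation.Nullary
open import Relation.Nullary.Decidable using (_×-dec_)
open import Relation.Unary using (Decidable)

open CommSemigroup *-commutativeSemigroup using (interchange)

private
  variable
    k m n p q : ℕ

keepIf : {P : ℕ → Set} → Decidable P → ℕ → ℕ
keepIf P? x = if does (P? x) then x else 1

product-filter : {P : ℕ → Set} (P? : Decidable P) (xs : List ℕ) →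
                 product (filter P? xs) ≡ product (map (keepIf P?) xs)
product-filter P? []       = refl
product-filter P? (x ∷ xs) with does (P? x)
... | true  = cong (x *_) (product-filter P? xs)
... | false = trans (product-filter P? xs) (sym (*-identityˡ _))

product-map-* : (f g : ℕ → ℕ) (xs : List ℕ) →
                product (map (λ x → f x * g x) xs) ≡ product (map f xs) * product (map g xs)
product-map-* f g []       = refl
product-map-* f g (x ∷ xs) = begin
  f x * g x * product (map (λ x → f x * g x) xs)
    ≡⟨ cong (f x * g x *_) (product-map-* f g xs) ⟩
  f x * g x * (product (map f xs) * product (map g xs))
    ≡⟨ interchange (f x) (g x) _ _ ⟩
  f x * product (map f xs) * (g x * product (map g xs)) ∎
  where open ≡-Reasoning

^-distribʳ-* : ∀ m n k → (m * n) ^ k ≡ m ^ k * n ^ k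
^-distribʳ-* m n zero    = refl
^-distribʳ-* m n (suc k) = trans (cong (m * n *_) (^-distribʳ-* m n k))
                                 (interchange m n (m ^ k) (n ^ k))

prime∤1 : Prime p → ¬ p ∣ 1
prime∤1 pp p∣1 = ¬prime[1] (subst Prime (∣1⇒≡1 p∣1) pp)

prime∤prime : Prime p → Prime q → p ≢ q → ¬ p ∣ q
prime∤prime pp pq p≢q p∣q with prime⇒irreducible pq p∣q
... | inj₁ refl = ¬prime[1] pp
... | inj₂ refl = p≢q refl

prime∤* : Prime p → ¬ p ∣ m → ¬ p ∣ n → ¬ p ∣ m * n
prime∤* pp p∤m p∤n p∣mn = [ p∤m , p∤n ]′ (euclidsLemma _ _ pp p∣mn)

prime∤^ : ∀ k → Prime p → ¬ p ∣ m → ¬ p ∣ m ^ k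
prime∤^ zero    pp p∤m = prime∤1 pp
prime∤^ (suc k) pp p∤m = prime∤* pp p∤m (prime∤^ k pp p∤m)

prime^∣*⇒∣ : ∀ {j} k → Prime p → ¬ p ∣ m → p ^ k ∣ j * m → p ^ k ∣ j
prime^∣*⇒∣ zero _ _ _ = 1∣ _
prime^∣*⇒∣ {p} {m} {j} (suc k) pp p∤m pᵏ⁺¹∣jm
  with euclidsLemma j m pp (∣-trans (m∣m*n (p ^ k)) pᵏ⁺¹∣jm)
... | inj₂ p∣m = contradiction p∣m p∤m
... | inj₁ (divides i refl) =
  subst (p * p ^ k ∣_) (*-comm p i) (*-monoʳ-∣ p (prime^∣*⇒∣ k pp p∤m pᵏ∣im))
  where
  instance _ = prime⇒nonZero pp
  pᵏ∣im : p ^ k ∣ i * m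
  pᵏ∣im = *-cancelˡ-∣ p (subst (p * p ^ k ∣_) (rearrange i p m) pᵏ⁺¹∣jm)
    where
    rearrange : ∀ i p m → i * p * m ≡ p * (i * m)
    rearrange = solve-∀

prime^*∣ : Prime p → ¬ p ∣ m → p ^ k ∣ n → m ∣ n → p ^ k * m ∣ n
prime^*∣ {p} {m} {k} pp p∤m pᵏ∣n (divides j refl) with prime^∣*⇒∣ {j = j} k pp p∤m pᵏ∣n
... | divides i refl = divides i (*-assoc i (p ^ k) m)

prime∤∏^ : (e : ℕ → ℕ) → (∀ x → ¬ Prime x → e x ≡ 0) →
           ∀ ys → Prime p → All (p ≢_) ys → ¬ p ∣ product (map (λ y → y ^ e y) ys)
prime∤∏^ e e≡0 []       pp []              = prime∤1 pp
prime∤∏^ {p} e e≡0 (y ∷ ys) pp (p≢y ∷ p≢ys) = prime∤* pp p∤yᵉ (prime∤∏^ e e≡0 ys pp p≢ys)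
  where
  p∤yᵉ : ¬ p ∣ y ^ e y
  p∤yᵉ with prime? y
  ... | yes py = prime∤^ (e y) pp (prime∤prime pp py p≢y)
  ... | no ¬py rewrite e≡0 y ¬py = prime∤1 pp

∏^-∣ : (e : ℕ → ℕ) → (∀ x → x ^ e x ∣ n) → (∀ x → ¬ Prime x → e x ≡ 0) →
       ∀ {xs} → AllPairs _≢_ xs → product (map (λ x → x ^ e x) xs) ∣ n
∏^-∣ e xᵉ∣n e≡0 [] = 1∣ _
∏^-∣ e xᵉ∣n e≡0 {x ∷ xs} (x≢xs ∷ distinct) with prime? x
... | yes px = prime^*∣ {k = e x} px (prime∤∏^ e e≡0 xs px x≢xs) (xᵉ∣n x)
                                  (∏^-∣ e xᵉ∣n e≡0 distinct)
... | no ¬px rewrite e≡0 x ¬px =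
  subst (_∣ _) (sym (*-identityˡ _)) (∏^-∣ e xᵉ∣n e≡0 distinct)

primeDivisor? : (n : ℕ) → Decidable (λ p → Prime p × p ∣ n)
primeDivisor? n p = prime? p ×-dec (p ∣? n)

squareDivides? : (n : ℕ) → Decidable (λ p → Prime p × p * p ∣ n)
squareDivides? n p = prime? p ×-dec (p * p ∣? n)

powerfulRad : ℕ → ℕ
powerfulRad n = product (filter (squareDivides? n) (upTo (suc n)))

-- For a prime x this is min (2, exponent of x in n).
valuation⊓2 : ℕ → ℕ → ℕ
valuation⊓2 n x =
  if does (onceDivides? n x) then 1 else if does (squareDivides? n x) then 2 else 0

module _ (n : ℕ) where
  private
    xs = upTo (suc n)
    once square : ℕ → ℕ
    once   = keepIf (onceDivides? n)
    square = keepIf (squareDivides? n)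

  keepIf-primeDivisor≡once*square : ∀ x → keepIf (primeDivisor? n) x ≡ once x * square x
  keepIf-primeDivisor≡once*square x with prime? x | x ∣? n | x * x ∣? n
  ... | yes _ | yes _  | yes _    = sym (*-identityˡ x)
  ... | yes _ | yes _  | no _     = sym (*-identityʳ x)
  ... | yes _ | no x∤n | yes x²∣n = contradiction (∣-trans (m∣m*n x) x²∣n) x∤n
  ... | yes _ | no _   | no _     = refl
  ... | no _  | _      | _        = refl

  once*square²≡^valuation⊓2 : ∀ x → once x * square x * square x ≡ x ^ valuation⊓2 n x
  once*square²≡^valuation⊓2 x with prime? x | x ∣? n | x * x ∣? n
  ... | yes _ | yes _  | yes _    = cong₂ _*_ (*-identityˡ x) (sym (*-identityʳ x))
  ... | yes _ | yes _  | no _     = *-identityʳ (x * 1)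
  ... | yes _ | no x∤n | yes x²∣n = contradiction (∣-trans (m∣m*n x) x²∣n) x∤n
  ... | yes _ | no _   | no _     = refl
  ... | no _  | _      | _        = refl

  ^valuation⊓2∣ : ∀ x → x ^ valuation⊓2 n x ∣ n
  ^valuation⊓2∣ x with prime? x | x ∣? n | x * x ∣? n
  ... | yes _ | yes _   | yes x²∣n = subst (_∣ n) (cong (x *_) (sym (*-identityʳ x))) x²∣n
  ... | yes _ | yes x∣n | no _     = subst (_∣ n) (sym (*-identityʳ x)) x∣n
  ... | yes _ | no x∤n  | yes x²∣n = contradiction (∣-trans (m∣m*n x) x²∣n) x∤n
  ... | yes _ | no _    | no _     = 1∣ n
  ... | no _  | _       | _        = 1∣ n

  valuation⊓2-nonPrime : ∀ x → ¬ Prime x → valuation⊓2 n x ≡ 0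
  valuation⊓2-nonPrime x ¬px with prime? x
  ... | yes px = contradiction px ¬px
  ... | no _   = refl

  rad≡sqfreePart*powerfulRad : rad n ≡ sqfreePart n * powerfulRad n
  rad≡sqfreePart*powerfulRad = begin
    rad n
      ≡⟨ product-filter (primeDivisor? n) xs ⟩
    product (map (keepIf (primeDivisor? n)) xs)
      ≡⟨ cong product (map-cong keepIf-primeDivisor≡once*square xs) ⟩
    product (map (λ x → once x * square x) xs)
      ≡⟨ product-map-* once square xs ⟩
    product (map once xs) * product (map square xs)
      ≡⟨ cong₂ _*_ (product-filter (onceDivides? n) xs) (product-filter (squareDivides? n) xs) ⟨
    sqfreePart n * powerfulRad n ∎
    where open ≡-Reasoning

  sqfreePart*powerfulRad²∣ : sqfreePart n * powerfulRad n * powerfulRad n ∣ n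
  sqfreePart*powerfulRad²∣ =
    subst (_∣ n) ∏≡ (∏^-∣ (valuation⊓2 n) ^valuation⊓2∣ valuation⊓2-nonPrime distinct)
    where
    open ≡-Reasoning
    distinct : AllPairs _≢_ xs
    distinct = applyUpTo⁺₁ id (suc n) (λ i<j _ → <⇒≢ i<j)
    ∏≡ : product (map (λ x → x ^ valuation⊓2 n x) xs) ≡ sqfreePart n * powerfulRad n * powerfulRad n
    ∏≡ = begin
      product (map (λ x → x ^ valuation⊓2 n x) xs)
        ≡⟨ cong product (map-cong once*square²≡^valuation⊓2 xs) ⟨
      product (map (λ x → once x * square x * square x) xs)
        ≡⟨ product-map-* (λ x → once x * square x) square xs ⟩
      product (map (λ x → once x * square x) xs) * product (map square xs)
        ≡⟨ cong (_* product (map square xs)) (product-map-* once square xs) ⟩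
      product (map once xs) * product (map square xs) * product (map square xs)
        ≡⟨ cong₂ (λ s t → s * t * t) (product-filter (onceDivides? n) xs)
                                     (product-filter (squareDivides? n) xs) ⟨
      sqfreePart n * powerfulRad n * powerfulRad n ∎

sqfreePart*vPart≡ : ∀ n → sqfreePart n * vPart n ≡ n
sqfreePart*vPart≡ n = m*[n/m]≡n {{sqfreePart≢0 n}}
  (∣-trans (∣-trans (m∣m*n (powerfulRad n)) (m∣m*n (powerfulRad n))) (sqfreePart*powerfulRad²∣ n))

vPart≢0 : ∀ n .{{_ : NonZero n}} → NonZero (vPart n)
vPart≢0 n = m*n≢0⇒n≢0 (sqfreePart n) {{subst NonZero (sym (sqfreePart*vPart≡ n)) it}}

powerfulRad²≤vPart : ∀ n .{{_ : NonZero n}} → powerfulRad n * powerfulRad n ≤ vPart n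
powerfulRad²≤vPart n = ∣⇒≤ {{vPart≢0 n}} (*-cancelˡ-∣ (sqfreePart n) {{sqfreePart≢0 n}} S*T²∣S*v)
  where
  S*T²∣S*v : sqfreePart n * (powerfulRad n * powerfulRad n) ∣ sqfreePart n * vPart n
  S*T²∣S*v = subst₂ _∣_ (*-assoc (sqfreePart n) (powerfulRad n) (powerfulRad n))
                        (sym (sqfreePart*vPart≡ n)) (sqfreePart*powerfulRad²∣ n)

powerfulPart-bound : ∀ K S T v {n r} p q .{{_ : NonZero S}} .{{_ : NonZero v}} →
                     n ≡ S * v → r ≡ S * T → T * T ≤ v →
                     n ^ (q + q) ≤ K * r ^ (q + q + p) → v ^ q ≤ K * r ^ p
powerfulPart-bound K S T v p q refl refl T²≤v bound =
  *-cancelʳ-≤ (v ^ q) (K * R ^ p) (v ^ q) {{m^n≢0 v q}}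
    (*-cancelˡ-≤ (S ^ (q + q)) {{m^n≢0 S (q + q)}} scaled)
  where
  open ≤-Reasoning
  R = S * T
  T^2q≤v^q : T ^ (q + q) ≤ v ^ q
  T^2q≤v^q = begin
    T ^ (q + q)   ≡⟨ ^-distribˡ-+-* T q q ⟩
    T ^ q * T ^ q ≡⟨ ^-distribʳ-* T T q ⟨
    (T * T) ^ q   ≤⟨ ^-monoˡ-≤ q T²≤v ⟩
    v ^ q         ∎
  scaled : S ^ (q + q) * (v ^ q * v ^ q) ≤ S ^ (q + q) * (K * R ^ p * v ^ q)
  scaled = begin
    S ^ (q + q) * (v ^ q * v ^ q)   ≡⟨ cong (S ^ (q + q) *_) (^-distribˡ-+-* v q q) ⟨
    S ^ (q + q) * v ^ (q + q)       ≡⟨ ^-distribʳ-* S v (q + q) ⟨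
    (S * v) ^ (q + q)               ≤⟨ bound ⟩
    K * R ^ (q + q + p)             ≡⟨ cong (K *_) (^-distribˡ-+-* R (q + q) p) ⟩
    K * (R ^ (q + q) * R ^ p)       ≡⟨ cong (λ x → K * (x * R ^ p)) (^-distribʳ-* S T (q + q)) ⟩
    K * (S ^ (q + q) * T ^ (q + q) * R ^ p)
      ≡⟨ rearrange K (S ^ (q + q)) (T ^ (q + q)) (R ^ p) ⟩
    S ^ (q + q) * (K * R ^ p * T ^ (q + q))
      ≤⟨ *-monoʳ-≤ (S ^ (q + q)) (*-monoʳ-≤ (K * R ^ p) T^2q≤v^q) ⟩
    S ^ (q + q) * (K * R ^ p * v ^ q) ∎
    where
    rearrange : ∀ k a b c → k * (a * b * c) ≡ a * (k * c * b)
    rearrange = solve-∀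

mainTheorem5 : (E : Weierstrass) → IsElliptic E → Hypothesis E → Conclusion E
mainTheorem5 E _ H p q p≥1 q≥1 with H p (q + q) p≥1 (≤-trans q≥1 (m≤m+n q q))
... | K , bound = K , λ x y a b d onCurve rep →
  let instance d≢0 = >-nonZero (proj₁ rep) in
  powerfulPart-bound K (sqfreePart d) (powerfulRad d) (vPart d) p q
    {{sqfreePart≢0 d}} {{vPart≢0 d}}
    (sym (sqfreePart*vPart≡ d)) (rad≡sqfreePart*powerfulRad d) (powerfulRad²≤vPart d)
    (proj₂ (bound x y a b d onCurve rep))
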